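{- Let $A$ be an animal on one of the boards (square, triangular, hexagonal or cubic) and let $\delta$ be the number of cells adjacent to a single cell of that board. If $a$ and $b$ are integers with $1\le a<|A|$ and $a\delta\le b$, then $A$ is an $(a,b)$-loser.
   Context: A board is one of the regular tilings: the square tiling of the plane, the tiling of the plane by equilateral triangles, the tiling of the plane by regular hexagons, or the tiling of space by unit cubes; its tiles are called cells. Two cells are adjacent if they share a common edge (a common face for cubes). Thus $\delta=4,3,6,6$ for the square, triangular, hexagonal and cubic boards respectively. An animal is a finite set of cells that is connected under adjacency, considered up to congruence (rotations, reflections and translations of the board); $|A|$ is its number of cells. For integers $a\ge1$, $b\ge0$, in the weak $(a,b)$ achievement game for the goal animal $A$, played on the infinite board, the maker and the breaker alternately mark cells, the maker starting; in each turn the maker marks $a$ previously unmarked cells and the breaker marks $b$ previously unmarked cells. The maker wins if at some point the set of cells he has marked contains a set of cells congruent to $A$. $A$ is an $(a,b)$-winner if the maker has a strategy guaranteeing a win (in finitely many turns) against every play of the breaker; otherwise $A$ is an $(a,b)$-loser. -}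

module Defs where

open import Data.Nat using (ℕ; zero; suc; _+_; _*_; _≤_; _<_)
open import Data.Integer as ℤ using (ℤ; ∣_∣; -_) renaming (_+_ to _+ℤ_; _-_ to _-ℤ_)
open import Data.Bool using (Bool; true; false; if_then_else_)
open import Data.Product using (Σ; ∃; ∃-syntax; _×_; _,_; proj₁; proj₂)
open import Data.List using (List; []; _∷_; _++_; length)
open import Data.List.Membership.Propositional using (_∈_; _∉_)
open import Data.List.Relation.Unary.All using (All)
open import Data.List.Relation.Unary.Unique.Propositional using (Unique)
open import Relation.Binary.PropositionalEquality using (_≡_)
open import Relation.Nullary using (¬_; yes; no)

ℤ² : Set
ℤ² = ℤ × ℤ

ℤ³ : Set
ℤ³ = ℤ × ℤ × ℤ

dist² : ℤ² → ℤ² → ℕ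
dist² (x , y) (x' , y') = ∣ x -ℤ x' ∣ + ∣ y -ℤ y' ∣

dist³ : ℤ³ → ℤ³ → ℕ
dist³ (x , y , z) (x' , y' , z') = ∣ x -ℤ x' ∣ + ∣ y -ℤ y' ∣ + ∣ z -ℤ z' ∣

_+³_ : ℤ³ → ℤ³ → ℤ³
(x , y , z) +³ (x' , y' , z') = (x +ℤ x' , y +ℤ y' , z +ℤ z')

neg³ : ℤ³ → ℤ³
neg³ (x , y , z) = (- x , - y , - z)

data Perm3 : Set where
  p123 p132 p213 p231 p312 p321 : Perm3

perm3 : Perm3 → ℤ³ → ℤ³
perm3 p123 (x , y , z) = (x , y , z)
perm3 p132 (x , y , z) = (x , z , y)
perm3 p213 (x , y , z) = (y , x , z)
perm3 p231 (x , y , z) = (y , z , x)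
perm3 p312 (x , y , z) = (z , x , y)
perm3 p321 (x , y , z) = (z , y , x)

negIf : Bool → ℤ → ℤ
negIf true  x = - x
negIf false x = x

record Board : Set₁ where
  field
    Cell : Set
    Adj  : Cell → Cell → Set
    Sym  : Set
    act  : Sym → Cell → Cell
    δ    : ℕ                    -- number of cells adjacent to one cell

squareAct : (Bool × Bool × Bool × ℤ²) → ℤ² → ℤ²
squareAct (s , n₁ , n₂ , (t₁ , t₂)) (x , y) =
  let u = if s then y else x
      v = if s then x else y
  in (negIf n₁ u +ℤ t₁ , negIf n₂ v +ℤ t₂)

squareBoard : Board
squareBoard = record
  { Cell = ℤ²
  ; Adj  = λ c d → dist² c d ≡ 1
  ; Sym  = Bool × Bool × Bool × ℤ²
  ; act  = squareAct
  ; δ    = 4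
  }

cubicAct : (Perm3 × Bool × Bool × Bool × ℤ³) → ℤ³ → ℤ³
cubicAct (p , n₁ , n₂ , n₃ , t) c with perm3 p c
... | (x , y , z) = (negIf n₁ x , negIf n₂ y , negIf n₃ z) +³ t

cubicBoard : Board
cubicBoard = record
  { Cell = ℤ³
  ; Adj  = λ c d → dist³ c d ≡ 1
  ; Sym  = Perm3 × Bool × Bool × Bool × ℤ³
  ; act  = cubicAct
  ; δ    = 6
  }

-- Hexagonal tiling: cells in axial coordinates (q , r), i.e. cube
-- coordinates (q , r , -q-r) of the triangular lattice of hexagon centres.
-- Adjacent iff cube-coordinate L1-distance is 2.
-- Symmetries: coordinate permutation, optional central inversion (12 point
-- maps, the dihedral group of order 12 about a cell centre), then translation.
hexToCube : ℤ² → ℤ³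
hexToCube (q , r) = (q , r , - (q +ℤ r))

hexFromCube : ℤ³ → ℤ²
hexFromCube (x , y , z) = (x , y)

hexAct : (Perm3 × Bool × ℤ²) → ℤ² → ℤ²
hexAct (p , n , (t₁ , t₂)) c with hexFromCube (perm3 p (hexToCube c))
... | (x , y) = (negIf n x +ℤ t₁ , negIf n y +ℤ t₂)

hexBoard : Board
hexBoard = record
  { Cell = ℤ²
  ; Adj  = λ c d → dist³ (hexToCube c) (hexToCube d) ≡ 2
  ; Sym  = Perm3 × Bool × ℤ²
  ; act  = hexAct
  ; δ    = 6
  }

-- Triangular tiling: cell (q , r , up) has triangle coordinates
-- (q , r , s) with q + r + s = 1 (up = false) or = 2 (up = true).
-- Two triangles are adjacent iff their triangle coordinates have
-- L1-distance 1.  Symmetries: coordinate permutation, optional map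
-- v ↦ (1,1,1) - v (the 12 point maps fixing a lattice vertex), then
-- translation by a vector (t₁ , t₂ , -t₁-t₂).
triToCoord : ℤ × ℤ × Bool → ℤ³
triToCoord (q , r , false) = (q , r , ℤ.+ 1 -ℤ (q +ℤ r))
triToCoord (q , r , true)  = (q , r , ℤ.+ 2 -ℤ (q +ℤ r))

triFromCoord : ℤ³ → ℤ × ℤ × Bool
triFromCoord (x , y , z) with (x +ℤ y +ℤ z) ℤ.≟ ℤ.+ 2
... | yes _ = (x , y , true)
... | no  _ = (x , y , false)

triInv : Bool → ℤ³ → ℤ³
triInv true  (x , y , z) = (ℤ.+ 1 -ℤ x , ℤ.+ 1 -ℤ y , ℤ.+ 1 -ℤ z)
triInv false v = v

triAct : (Perm3 × Bool × ℤ²) → ℤ × ℤ × Bool → ℤ × ℤ × Bool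
triAct (p , n , (t₁ , t₂)) c =
  triFromCoord (triInv n (perm3 p (triToCoord c)) +³ (t₁ , t₂ , - (t₁ +ℤ t₂)))

triangularBoard : Board
triangularBoard = record
  { Cell = ℤ × ℤ × Bool
  ; Adj  = λ c d → dist³ (triToCoord c) (triToCoord d) ≡ 1
  ; Sym  = Perm3 × Bool × ℤ²
  ; act  = triAct
  ; δ    = 3
  }

data BoardKind : Set where
  square triangular hexagonal cubic : BoardKind

board : BoardKind → Board
board square     = squareBoard
board triangular = triangularBoard
board hexagonal  = hexBoard
board cubic      = cubicBoard

module _ (B : Board) where
  open Board B

  data PathIn (S : List Cell) : Cell → Cell → Set where
    stop : ∀ {c} → c ∈ S → PathIn S c c
    step : ∀ {c d e} → c ∈ S → Adj c d → PathIn S d e → PathIn S c e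

  -- An animal: a finite set (duplicate-free list) of cells, connected
  -- under adjacency.  (Congruent representatives give the same game.)
  record Animal : Set where
    field
      cells     : List Cell
      distinct  : Unique cells
      connected : ∀ {c d} → c ∈ cells → d ∈ cells → PathIn cells c d

  size : Animal → ℕ
  size A = length (Animal.cells A)

  ContainsCopy : Animal → List Cell → Set
  ContainsCopy A S = ∃[ g ] All (λ c → act g c ∈ S) (Animal.cells A)

  LegalMove : ℕ → List Cell → List Cell → Set
  LegalMove k marked mv = length mv ≡ k × Unique mv × All (_∉ marked) mv

  -- A strategy sees the cells marked so far by maker and by breaker
  -- (in the order marked, which encodes the whole history).
  Strategy : ℕ → Set
  Strategy k = Σ (List Cell → List Cell → List Cell)
                 (λ σ → ∀ mk br → LegalMove k (mk ++ br) (σ mk br))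

  play : ∀ {a b} → Strategy a → Strategy b → ℕ → List Cell × List Cell
  play σ τ zero = ([] , [])
  play σ τ (suc n) with play σ τ n
  ... | (mk , br) =
    let mk' = mk ++ proj₁ σ mk br
    in (mk' , br ++ proj₁ τ mk' br)

  Winner : Animal → ℕ → ℕ → Set
  Winner A a b = Σ (Strategy a) λ σ → (τ : Strategy b) →
                   ∃[ n ] ContainsCopy A (proj₁ (play σ τ n))

  Loser : Animal → ℕ → ℕ → Set
  Loser A a b = ¬ Winner A a b

module Submission where

-- The breaker plays the "isolating" strategy: after each maker move he marks
-- every still unmarked neighbour of the cells just played (at most aδ ≤ b
-- cells, filled up with arbitrary fresh cells).  By induction every neighbour
-- of a maker cell is then marked after each turn, so a cell of a later maker
-- move is never adjacent to a cell of an earlier one.  Hence any connected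
-- set of maker cells, in particular a copy of A, lies inside a single move,
-- and by the pigeonhole principle has at most a < |A| cells.

open import Defs
open import Level using (0ℓ)
open import Function using (_∘_; case_of_)
open import Algebra.Bundles using (CommutativeSemigroup)
import Algebra.Properties.CommutativeSemigroup as CommSemigroupProperties
open import Data.Bool using (Bool; true; false; if_then_else_)
open import Data.Nat using (ℕ; zero; suc; _+_; _*_; _∸_; _≤_; _<_; z≤n; s≤s)
import Data.Nat.Properties as ℕ
open import Data.Integer as ℤ using (ℤ; +_; -[1+_]; ∣_∣; -_; +0) renaming (_+_ to _+ℤ_; _-_ to _-ℤ_)
import Data.Integer.Properties as ℤ
open import Data.Integer.Tactic.RingSolver using (solve-∀)
open import Data.Product using (_,_; proj₁; proj₂; ∃-syntax)
import Data.Product.Properties as Product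
open import Data.Sum using (_⊎_; inj₁; inj₂)
open import Data.Empty using (⊥-elim)
open import Data.List using (List; []; _∷_; _++_; length; map; concatMap; drop; upTo; cartesianProduct)
open import Data.List.Properties using (length-++; length-map; length-++-sucʳ)
open import Data.List.Membership.Propositional using (_∈_; _∉_)
open import Data.List.Membership.Propositional.Properties
  using (∈-++⁺ˡ; ∈-++⁺ʳ; ∈-++⁻; ∈-∃++; ∈-map⁺; ∈-upTo⁺; ∈-cartesianProduct⁺)
open import Data.List.Relation.Binary.Subset.Propositional using (_⊆_)
open import Data.List.Relation.Binary.Subset.Propositional.Properties using (xs⊆xs++ys; ++⁺; ++⁺ʳ)
open import Data.List.Relation.Unary.Any using (here; there)
open import Data.List.Relation.Unary.All as All using (All; []; _∷_; all?)
import Data.List.Relation.Unary.All.Properties as All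
open import Data.List.Relation.Unary.AllPairs using ([]; _∷_)
open import Data.List.Relation.Unary.Unique.Propositional using (Unique)
import Data.List.Relation.Unary.Unique.Propositional.Properties as Unique
open import Relation.Binary.Definitions using (DecidableEquality; tri<; tri≈; tri>)
open import Relation.Binary.PropositionalEquality
  using (_≡_; refl; sym; trans; cong; cong₂; subst; module ≡-Reasoning)
open import Relation.Nullary using (¬_; yes; no)
open import Relation.Nullary.Decidable using (True; toWitness; map′; _→-dec_)
open import Relation.Unary using (Pred; Decidable)

-- Pigeonhole principle for lists: a duplicate-free list all of whose
-- elements occur in ys is no longer than ys.  It bounds the size of a copy
-- of the animal that lies inside a single move.
unique⊆⇒length≤ : ∀ {X : Set} {xs ys : List X} → Unique xs → xs ⊆ ys → length xs ≤ length ys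
unique⊆⇒length≤ [] _ = z≤n
unique⊆⇒length≤ {xs = x ∷ xs} (x≢xs ∷ unique) xs⊆ys with ∈-∃++ (xs⊆ys (here refl))
... | us , vs , refl = begin
    suc (length xs)          ≤⟨ s≤s (unique⊆⇒length≤ unique without-x) ⟩
    suc (length (us ++ vs))  ≡⟨ sym (length-++-sucʳ us x vs) ⟩
    length (us ++ x ∷ vs)    ∎
  where
  open ℕ.≤-Reasoning
  -- every element of xs differs from x, so it survives deleting x from ys
  without-x : ∀ {y} → y ∈ xs → y ∈ us ++ vs
  without-x y∈xs with ∈-++⁻ us (xs⊆ys (there y∈xs))
  ... | inj₁ y∈us         = ∈-++⁺ˡ y∈us
  ... | inj₂ (here refl)  = ⊥-elim (All.lookup x≢xs y∈xs refl)
  ... | inj₂ (there y∈vs) = ∈-++⁺ʳ us y∈vs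

path-start : ∀ (B : Board) {S c d} → PathIn B S c d → c ∈ S
path-start B (stop c∈S)     = c∈S
path-start B (step c∈S _ _) = c∈S

record LocallyFinite (B : Board) : Set where
  open Board B
  field
    _≟_           : DecidableEquality Cell
    fresh         : List Cell → Cell
    fresh∉        : ∀ M → fresh M ∉ M
    nbrs          : Cell → List Cell
    nbrs-length   : ∀ c → length (nbrs c) ≤ δ
    nbrs-complete : ∀ {c d} → Adj c d → d ∈ nbrs c
    Adj-sym       : ∀ {c d} → Adj c d → Adj d c
    act-Adj       : ∀ g {c d} → Adj c d → Adj (act g c) (act g d)
    act-inj       : ∀ g {c d} → act g c ≡ act g d → c ≡ d

module Isolation {B : Board} (F : LocallyFinite B) where
  open Board B
  open LocallyFinite F
  open import Data.List.Membership.DecPropositional _≟_ using (_∈?_)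

  extend-legal : ∀ {k x M mv} → x ∉ M → LegalMove B k (x ∷ M) mv → LegalMove B (suc k) M (x ∷ mv)
  extend-legal x∉M (refl , unique , outside) =
    refl ,
    All.map (λ y∉x∷M x≡y → y∉x∷M (here (sym x≡y))) outside ∷ unique ,
    x∉M ∷ All.map (λ y∉x∷M y∈M → y∉x∷M (there y∈M)) outside

  pad : ℕ → List Cell → List Cell
  pad zero    M = []
  pad (suc n) M = fresh M ∷ pad n (fresh M ∷ M)

  pad-legal : ∀ n M → LegalMove B n M (pad n M)
  pad-legal zero    M = refl , [] , []
  pad-legal (suc n) M = extend-legal (fresh∉ M) (pad-legal n (fresh M ∷ M))

  cover : ℕ → List Cell → List Cell → List Cell
  cover n       M []      = pad n M
  cover zero    M (c ∷ C) = []
  cover (suc n) M (c ∷ C) with c ∈? M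
  ... | yes _ = cover (suc n) M C
  ... | no  _ = c ∷ cover n (c ∷ M) C

  cover-legal : ∀ n M C → LegalMove B n M (cover n M C)
  cover-legal n       M []      = pad-legal n M
  cover-legal zero    M (c ∷ C) = refl , [] , []
  cover-legal (suc n) M (c ∷ C) with c ∈? M
  ... | yes _   = cover-legal (suc n) M C
  ... | no  c∉M = extend-legal c∉M (cover-legal n (c ∷ M) C)

  cover-complete : ∀ n M C → length C ≤ n → ∀ {y} → y ∈ C → y ∈ M ⊎ y ∈ cover n M C
  cover-complete (suc n) M (c ∷ C) (s≤s |C|≤n) {y} y∈c∷C with c ∈? M
  ... | yes c∈M = skip y∈c∷C
    where
    skip : y ∈ c ∷ C → y ∈ M ⊎ y ∈ cover (suc n) M C
    skip (here refl) = inj₁ c∈M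
    skip (there y∈C) = cover-complete (suc n) M C (ℕ.m≤n⇒m≤1+n |C|≤n) y∈C
  ... | no _ = take y∈c∷C
    where
    take : y ∈ c ∷ C → y ∈ M ⊎ y ∈ c ∷ cover n (c ∷ M) C
    take (here refl) = inj₂ (here refl)
    take (there y∈C) with cover-complete n (c ∷ M) C |C|≤n y∈C
    ... | inj₁ (here refl) = inj₂ (here refl)
    ... | inj₁ (there y∈M) = inj₁ y∈M
    ... | inj₂ y∈move      = inj₂ (there y∈move)

  neighbourhood : List Cell → List Cell
  neighbourhood = concatMap nbrs

  length-neighbourhood : ∀ L → length (neighbourhood L) ≤ length L * δ
  length-neighbourhood []      = z≤n
  length-neighbourhood (x ∷ L) = begin
      length (nbrs x ++ neighbourhood L)            ≡⟨ length-++ (nbrs x) ⟩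
      length (nbrs x) + length (neighbourhood L)    ≤⟨ ℕ.+-mono-≤ (nbrs-length x) (length-neighbourhood L) ⟩
      δ + length L * δ                              ∎
    where open ℕ.≤-Reasoning

  ∈-neighbourhood : ∀ L {x y} → x ∈ L → Adj x y → y ∈ neighbourhood L
  ∈-neighbourhood (z ∷ L) (here refl) adj = ∈-++⁺ˡ (nbrs-complete adj)
  ∈-neighbourhood (z ∷ L) (there x∈L) adj = ∈-++⁺ʳ (nbrs z) (∈-neighbourhood L x∈L adj)

  lastMove : ℕ → List Cell → List Cell
  lastMove a mk = drop (length mk ∸ a) mk

  lastMove-++ : ∀ mk mv → lastMove (length mv) (mk ++ mv) ≡ mv
  lastMove-++ mk mv rewrite length-++ mk {mv} | ℕ.m+n∸n≡m (length mk) (length mv) = drop-all mk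
    where
    drop-all : ∀ xs → drop (length xs) (xs ++ mv) ≡ mv
    drop-all []       = refl
    drop-all (_ ∷ xs) = drop-all xs

  isolator : (a b : ℕ) → Strategy B b
  isolator a b = (λ mk br → cover b (mk ++ br) (neighbourhood (lastMove a mk)))
               , (λ mk br → cover-legal b (mk ++ br) (neighbourhood (lastMove a mk)))

  module AgainstIsolator (a b : ℕ) (aδ≤b : a * δ ≤ b) (σ : Strategy B a) where

    mk br marked move reply : ℕ → List Cell
    mk n     = proj₁ (play B σ (isolator a b) n)
    br n     = proj₂ (play B σ (isolator a b) n)
    marked n = mk n ++ br n
    move n   = proj₁ σ (mk n) (br n)
    reply n  = proj₁ (isolator a b) (mk n ++ move n) (br n)

    move-legal : ∀ n → LegalMove B a (marked n) (move n)
    move-legal n = proj₂ σ (mk n) (br n)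

    reply-covers : ∀ n {y} → y ∈ neighbourhood (move n) →
                   y ∈ (mk n ++ move n) ++ br n ⊎ y ∈ reply n
    reply-covers n y∈N = cover-complete b ((mk n ++ move n) ++ br n) _ |N|≤b
      (subst (λ L → _ ∈ neighbourhood L) (sym last≡move) y∈N)
      where
      last≡move : lastMove a (mk n ++ move n) ≡ move n
      last≡move = subst (λ k → lastMove k (mk n ++ move n) ≡ move n)
                        (proj₁ (move-legal n)) (lastMove-++ (mk n) (move n))
      |N|≤b : length (neighbourhood (lastMove a (mk n ++ move n))) ≤ b
      |N|≤b = subst (λ L → length (neighbourhood L) ≤ b) (sym last≡move)
                (ℕ.≤-trans (length-neighbourhood (move n))
                   (subst (λ k → k * δ ≤ b) (sym (proj₁ (move-legal n))) aδ≤b))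

    neighbours-marked : ∀ n {x y} → x ∈ mk n → Adj x y → y ∈ marked n
    neighbours-marked (suc n) x∈ adj with ∈-++⁻ (mk n) x∈
    ... | inj₁ x∈old = ++⁺ (xs⊆xs++ys (mk n) (move n)) (xs⊆xs++ys (br n) (reply n))
                             (neighbours-marked n x∈old adj)
    ... | inj₂ x∈new with reply-covers n (∈-neighbourhood (move n) x∈new adj)
    ...   | inj₁ y∈before = ++⁺ʳ (mk n ++ move n) (xs⊆xs++ys (br n) (reply n)) y∈before
    ...   | inj₂ y∈reply  = ∈-++⁺ʳ (mk n ++ move n) (∈-++⁺ʳ (br n) y∈reply)

    move⊆mk : ∀ {t n} → t < n → move t ⊆ mk n
    move⊆mk {t} {suc n} (s≤s t≤n) with ℕ.m≤n⇒m<n∨m≡n t≤n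
    ... | inj₁ t<n  = ∈-++⁺ˡ ∘ move⊆mk t<n
    ... | inj₂ refl = ∈-++⁺ʳ (mk n)

    mk⊆moves : ∀ n {x} → x ∈ mk n → ∃[ t ] x ∈ move t
    mk⊆moves (suc n) x∈ with ∈-++⁻ (mk n) x∈
    ... | inj₁ x∈old = mk⊆moves n x∈old
    ... | inj₂ x∈new = n , x∈new

    -- a cell of a later move is never adjacent to a cell of an earlier one,
    -- since it was unmarked when played
    later-not-adjacent : ∀ {t s x y} → t < s → x ∈ move t → y ∈ move s → ¬ Adj x y
    later-not-adjacent {s = s} t<s x∈ y∈ adj =
      All.lookup (proj₂ (proj₂ (move-legal s))) y∈ (neighbours-marked s (move⊆mk t<s x∈) adj)

    moves-separated : ∀ {t s x y} → x ∈ move t → y ∈ move s → Adj x y → t ≡ s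
    moves-separated {t} {s} x∈ y∈ adj with ℕ.<-cmp t s
    ... | tri< t<s _ _ = ⊥-elim (later-not-adjacent t<s x∈ y∈ adj)
    ... | tri≈ _ t≡s _ = t≡s
    ... | tri> _ _ s<t = ⊥-elim (later-not-adjacent s<t y∈ x∈ (Adj-sym adj))

    connected-in-one-move : ∀ n t {S} (h : Cell → Cell) → (∀ {c d} → Adj c d → Adj (h c) (h d)) →
      All (λ c → h c ∈ mk n) S → ∀ {c d} → PathIn B S c d → h c ∈ move t → h d ∈ move t
    connected-in-one-move n t h h-Adj inS (stop _) hc∈ = hc∈
    connected-in-one-move n t h h-Adj inS (step _ adj path) hc∈
      with mk⊆moves n (All.lookup inS (path-start B path))
    ... | s , hd∈ with moves-separated {t} {s} hc∈ hd∈ (h-Adj adj)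
    ...   | refl = connected-in-one-move n t h h-Adj inS path hd∈

  loser : (A : Animal B) (a b : ℕ) → a < size B A → a * δ ≤ b → Loser B A a b
  loser A a b a<|A| aδ≤b (σ , wins) with wins (isolator a b)
  ... | n , g , copy = ℕ.<⇒≱ a<|A| |A|≤a
    where
    open AgainstIsolator a b aδ≤b σ
    open Animal A
    nonempty : ∀ {X : Set} {xs : List X} → a < length xs → ∃[ x ] x ∈ xs
    nonempty {xs = x ∷ _} _ = x , here refl
    root = nonempty a<|A|
    root-move = mk⊆moves n (All.lookup copy (proj₂ root))
    t = proj₁ root-move
    -- A is connected, so its whole image lies in move t
    copy-in-move : All (λ c → act g c ∈ move t) cells
    copy-in-move = All.tabulate λ c∈ →
      connected-in-one-move n t (act g) (act-Adj g) copy (connected (proj₂ root) c∈) (proj₂ root-move)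
    |A|≤a : size B A ≤ a
    |A|≤a = begin
        length cells              ≡⟨ sym (length-map (act g) cells) ⟩
        length (map (act g) cells) ≤⟨ unique⊆⇒length≤ (Unique.map⁺ (act-inj g) distinct)
                                        (All.lookup (All.map⁺ copy-in-move)) ⟩
        length (move t)           ≡⟨ proj₁ (move-legal t) ⟩
        a                         ∎
      where open ℕ.≤-Reasoning

module CoordinateSum (S : CommutativeSemigroup 0ℓ 0ℓ) where
  open CommutativeSemigroup S using (Carrier; _∙_; _≈_) renaming (refl to ≈-refl)
  open CommSemigroupProperties S

  sumOver : (ℤ → Carrier) → ℤ³ → Carrier
  sumOver f (x , y , z) = f x ∙ f y ∙ f z

  sumOver-perm : ∀ f p v → sumOver f (perm3 p v) ≈ sumOver f v
  sumOver-perm f p123 v           = ≈-refl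
  sumOver-perm f p132 (x , y , z) = xy∙z≈xz∙y (f x) (f z) (f y)
  sumOver-perm f p213 (x , y , z) = xy∙z≈yx∙z (f y) (f x) (f z)
  sumOver-perm f p231 (x , y , z) = xy∙z≈zx∙y (f y) (f z) (f x)
  sumOver-perm f p312 (x , y , z) = xy∙z≈yz∙x (f z) (f x) (f y)
  sumOver-perm f p321 (x , y , z) = xy∙z≈zy∙x (f z) (f y) (f x)

module ℕSum = CoordinateSum ℕ.+-commutativeSemigroup
module ℤSum = CoordinateSum ℤ.+-commutativeSemigroup

-- the L1 norm; dist³ v w is by definition absSum (v -³ w)
absSum : ℤ³ → ℕ
absSum = ℕSum.sumOver ∣_∣

coordSum : ℤ³ → ℤ
coordSum = ℤSum.sumOver (λ x → x)

_-³_ : ℤ³ → ℤ³ → ℤ³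
(x , y , z) -³ (x' , y' , z') = (x -ℤ x' , y -ℤ y' , z -ℤ z')

-- the sign changes of a cube congruence; cubicAct (p , n₁ , n₂ , n₃ , t) v
-- is by definition negs n₁ n₂ n₃ (perm3 p v) +³ t
negs : Bool → Bool → Bool → ℤ³ → ℤ³
negs n₁ n₂ n₃ (x , y , z) = (negIf n₁ x , negIf n₂ y , negIf n₃ z)

sum3-cong : ∀ {a b c a' b' c' : ℕ} → a ≡ a' → b ≡ b' → c ≡ c' → a + b + c ≡ a' + b' + c'
sum3-cong ea eb ec = cong₂ _+_ (cong₂ _+_ ea eb) ec

dist³-sym : ∀ v w → dist³ v w ≡ dist³ w v
dist³-sym (x , y , z) (x' , y' , z') =
  sum3-cong (ℤ.∣i-j∣≡∣j-i∣ x x') (ℤ.∣i-j∣≡∣j-i∣ y y') (ℤ.∣i-j∣≡∣j-i∣ z z')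

dist³-self : ∀ v → dist³ v v ≡ 0
dist³-self (x , y , z) = sum3-cong (self x) (self y) (self z)
  where
  self : ∀ i → ∣ i -ℤ i ∣ ≡ ∣ +0 -ℤ +0 ∣
  self i = cong ∣_∣ (ℤ.+-inverseʳ i)

dist³≡0⇒≡ : ∀ v w → dist³ v w ≡ 0 → v ≡ w
dist³≡0⇒≡ (x , y , z) (x' , y' , z') d≡0
  with same x x' (ℕ.m+n≡0⇒m≡0 _ (ℕ.m+n≡0⇒m≡0 _ d≡0))
     | same y y' (ℕ.m+n≡0⇒n≡0 ∣ x -ℤ x' ∣ (ℕ.m+n≡0⇒m≡0 _ d≡0))
     | same z z' (ℕ.m+n≡0⇒n≡0 (∣ x -ℤ x' ∣ + ∣ y -ℤ y' ∣) d≡0)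
  where
  same : ∀ i j → ∣ i -ℤ j ∣ ≡ 0 → i ≡ j
  same i j e = ℤ.i-j≡0⇒i≡j i j (ℤ.∣i∣≡0⇒i≡0 e)
... | refl | refl | refl = refl

dist³-translate : ∀ v w t → dist³ (v +³ t) (w +³ t) ≡ dist³ v w
dist³-translate (x , y , z) (x' , y' , z') (a , b , c) = sum3-cong (shift x x' a) (shift y y' b) (shift z z' c)
  where
  shift : ∀ i j k → ∣ (i +ℤ k) -ℤ (j +ℤ k) ∣ ≡ ∣ i -ℤ j ∣
  shift i j k = cong ∣_∣ (lemma i j k)
    where
    lemma : ∀ i j k → (i +ℤ k) -ℤ (j +ℤ k) ≡ i -ℤ j
    lemma = solve-∀

dist³-negs : ∀ n₁ n₂ n₃ v w → dist³ (negs n₁ n₂ n₃ v) (negs n₁ n₂ n₃ w) ≡ dist³ v w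
dist³-negs n₁ n₂ n₃ (x , y , z) (x' , y' , z') = sum3-cong (flip n₁ x x') (flip n₂ y y') (flip n₃ z z')
  where
  flip : ∀ n i j → ∣ negIf n i -ℤ negIf n j ∣ ≡ ∣ i -ℤ j ∣
  flip false i j = refl
  flip true  i j = trans (cong ∣_∣ (lemma i j)) (ℤ.∣-i∣≡∣i∣ (i -ℤ j))
    where
    lemma : ∀ i j → - i -ℤ - j ≡ - (i -ℤ j)
    lemma = solve-∀

dist³-perm : ∀ p v w → dist³ (perm3 p v) (perm3 p w) ≡ dist³ v w
dist³-perm p123 v w = refl
dist³-perm p132 v w = ℕSum.sumOver-perm ∣_∣ p132 (v -³ w)
dist³-perm p213 v w = ℕSum.sumOver-perm ∣_∣ p213 (v -³ w)
dist³-perm p231 v w = ℕSum.sumOver-perm ∣_∣ p231 (v -³ w)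
dist³-perm p312 v w = ℕSum.sumOver-perm ∣_∣ p312 (v -³ w)
dist³-perm p321 v w = ℕSum.sumOver-perm ∣_∣ p321 (v -³ w)

dist³-cubicAct : ∀ g v w → dist³ (cubicAct g v) (cubicAct g w) ≡ dist³ v w
dist³-cubicAct (p , n₁ , n₂ , n₃ , t) v w = begin
  dist³ (negs n₁ n₂ n₃ (perm3 p v) +³ t) (negs n₁ n₂ n₃ (perm3 p w) +³ t)
    ≡⟨ dist³-translate (negs n₁ n₂ n₃ (perm3 p v)) (negs n₁ n₂ n₃ (perm3 p w)) t ⟩
  dist³ (negs n₁ n₂ n₃ (perm3 p v)) (negs n₁ n₂ n₃ (perm3 p w))
    ≡⟨ dist³-negs n₁ n₂ n₃ (perm3 p v) (perm3 p w) ⟩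
  dist³ (perm3 p v) (perm3 p w)
    ≡⟨ dist³-perm p v w ⟩
  dist³ v w ∎
  where open ≡-Reasoning

coordSum-diff : ∀ v w → coordSum (v -³ w) ≡ coordSum v -ℤ coordSum w
coordSum-diff (x , y , z) (x' , y' , z') = lemma x y z x' y' z'
  where
  lemma : ∀ x y z x' y' z' → (x -ℤ x') +ℤ (y -ℤ y') +ℤ (z -ℤ z') ≡ (x +ℤ y +ℤ z) -ℤ (x' +ℤ y' +ℤ z')
  lemma = solve-∀

coordSum-cubicAct : ∀ p n t v → coordSum (cubicAct (p , n , n , n , t) v) ≡ negIf n (coordSum v) +ℤ coordSum t
coordSum-cubicAct p n (a , b , c) v = begin
  coordSum (negs n n n (perm3 p v) +³ (a , b , c))
    ≡⟨ signed n (perm3 p v) ⟩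
  negIf n (coordSum (perm3 p v)) +ℤ (a +ℤ b +ℤ c)
    ≡⟨ cong (λ s → negIf n s +ℤ (a +ℤ b +ℤ c)) (ℤSum.sumOver-perm (λ x → x) p v) ⟩
  negIf n (coordSum v) +ℤ (a +ℤ b +ℤ c) ∎
  where
  open ≡-Reasoning
  signed : ∀ n u → coordSum (negs n n n u +³ (a , b , c)) ≡ negIf n (coordSum u) +ℤ (a +ℤ b +ℤ c)
  signed false (x , y , z) = lemma x y z a b c
    where
    lemma : ∀ x y z a b c → (x +ℤ a) +ℤ (y +ℤ b) +ℤ (z +ℤ c) ≡ (x +ℤ y +ℤ z) +ℤ (a +ℤ b +ℤ c)
    lemma = solve-∀
  signed true (x , y , z) = lemma x y z a b c
    where
    lemma : ∀ x y z a b c → (- x +ℤ a) +ℤ (- y +ℤ b) +ℤ (- z +ℤ c) ≡ - (x +ℤ y +ℤ z) +ℤ (a +ℤ b +ℤ c)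
    lemma = solve-∀

plane-ext : ∀ {x y z z'} → coordSum (x , y , z) ≡ coordSum (x , y , z') → (x , y , z) ≡ (x , y , z')
plane-ext {x} {y} {z} {z'} same = cong (λ w → (x , y , w)) (begin
  z                          ≡⟨ third x y z ⟩
  (x +ℤ y +ℤ z) -ℤ (x +ℤ y)  ≡⟨ cong (_-ℤ (x +ℤ y)) same ⟩
  (x +ℤ y +ℤ z') -ℤ (x +ℤ y) ≡⟨ third x y z' ⟨
  z'                         ∎)
  where
  open ≡-Reasoning
  third : ∀ x y z → z ≡ (x +ℤ y +ℤ z) -ℤ (x +ℤ y)
  third = solve-∀

-- Finite search: a decidable property holds for all vectors of L1 norm at
-- most n once it holds on the finite box of vectors whose coordinates have
-- absolute value at most n, and that is checked by evaluation.
smallInts : ℕ → List ℤ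
smallInts n = map +_ (upTo (suc n)) ++ map -[1+_] (upTo n)

∈-smallInts : ∀ {n} i → ∣ i ∣ ≤ n → i ∈ smallInts n
∈-smallInts (+ m)    m≤n = ∈-++⁺ˡ (∈-map⁺ +_ (∈-upTo⁺ (s≤s m≤n)))
∈-smallInts -[1+ m ] m<n = ∈-++⁺ʳ _ (∈-map⁺ -[1+_] (∈-upTo⁺ m<n))

box : ℕ → List ℤ³
box n = cartesianProduct (smallInts n) (cartesianProduct (smallInts n) (smallInts n))

∈-box : ∀ {n} e → absSum e ≤ n → e ∈ box n
∈-box {n} (x , y , z) |e|≤n =
  ∈-cartesianProduct⁺ (∈-smallInts x |x|≤n)
    (∈-cartesianProduct⁺ (∈-smallInts y |y|≤n) (∈-smallInts z |z|≤n))
  where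
  |xy|≤n : ∣ x ∣ + ∣ y ∣ ≤ n
  |xy|≤n = ℕ.≤-trans (ℕ.m≤m+n (∣ x ∣ + ∣ y ∣) ∣ z ∣) |e|≤n
  |x|≤n : ∣ x ∣ ≤ n
  |x|≤n = ℕ.≤-trans (ℕ.m≤m+n ∣ x ∣ ∣ y ∣) |xy|≤n
  |y|≤n : ∣ y ∣ ≤ n
  |y|≤n = ℕ.≤-trans (ℕ.m≤n+m ∣ y ∣ ∣ x ∣) |xy|≤n
  |z|≤n : ∣ z ∣ ≤ n
  |z|≤n = ℕ.≤-trans (ℕ.m≤n+m ∣ z ∣ (∣ x ∣ + ∣ y ∣)) |e|≤n

search : ∀ n {P : Pred ℤ³ 0ℓ} (P? : Decidable P) → {True (all? P? (box n))} → ∀ e → absSum e ≤ n → P e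
search n P? {holds} e |e|≤n = All.lookup (toWitness holds) (∈-box e |e|≤n)

_≟³_ : DecidableEquality ℤ³
_≟³_ = Product.≡-dec ℤ._≟_ (Product.≡-dec ℤ._≟_ ℤ._≟_)

open import Data.List.Membership.DecPropositional _≟³_ using () renaming (_∈?_ to _∈³?_)

record CubeEmbedding (B : Board) : Set where
  open Board B
  field
    φ             : Cell → ℤ³
    ψ             : ℤ³ → Cell
    ψ∘φ           : ∀ c → ψ (φ c) ≡ c
    adjDist       : ℕ
    Adj⇒dist      : ∀ {c d} → Adj c d → dist³ (φ c) (φ d) ≡ adjDist
    dist⇒Adj      : ∀ {c d} → dist³ (φ c) (φ d) ≡ adjDist → Adj c d
    cubeSym       : Sym → Board.Sym cubicBoard
    φ-act         : ∀ g c → φ (act g c) ≡ cubicAct (cubeSym g) (φ c)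
    dirs          : Cell → List ℤ³
    dirs-length   : ∀ c → length (dirs c) ≤ δ
    dirs-complete : ∀ {c d} → Adj c d → φ d -³ φ c ∈ dirs c
    far           : ℕ → Cell
    far-height    : ∀ n → ∣ proj₁ (φ (far n)) ∣ ≡ n

module FromCubeEmbedding {B : Board} (E : CubeEmbedding B) where
  open Board B
  open CubeEmbedding E

  φ-inj : ∀ {c d} → φ c ≡ φ d → c ≡ d
  φ-inj {c} {d} e = trans (sym (ψ∘φ c)) (trans (cong ψ e) (ψ∘φ d))

  dist-act : ∀ g c d → dist³ (φ (act g c)) (φ (act g d)) ≡ dist³ (φ c) (φ d)
  dist-act g c d = trans (cong₂ dist³ (φ-act g c) (φ-act g d)) (dist³-cubicAct (cubeSym g) (φ c) (φ d))

  -- congruences are injective, since they preserve distances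
  act-injective : ∀ g {c d} → act g c ≡ act g d → c ≡ d
  act-injective g {c} {d} e = φ-inj (dist³≡0⇒≡ (φ c) (φ d) (begin
    dist³ (φ c) (φ d)                  ≡⟨ dist-act g c d ⟨
    dist³ (φ (act g c)) (φ (act g d))  ≡⟨ cong (λ x → dist³ (φ (act g c)) (φ x)) e ⟨
    dist³ (φ (act g c)) (φ (act g c))  ≡⟨ dist³-self (φ (act g c)) ⟩
    0                                  ∎))
    where open ≡-Reasoning

  ψ-displace : ∀ c d → ψ (φ c +³ (φ d -³ φ c)) ≡ d
  ψ-displace c d = trans (cong ψ (displace (φ c) (φ d))) (ψ∘φ d)
    where
    displace : ∀ v w → v +³ (w -³ v) ≡ w
    displace (x , y , z) (x' , y' , z') = cong₂ _,_ (back x x') (cong₂ _,_ (back y y') (back z z'))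
      where
      back : ∀ i j → i +ℤ (j -ℤ i) ≡ j
      back = solve-∀

  -- fresh cells: far (suc (heights M)) has a larger height than every cell of M
  height : Cell → ℕ
  height c = ∣ proj₁ (φ c) ∣

  heights : List Cell → ℕ
  heights []      = 0
  heights (c ∷ M) = height c + heights M

  height≤heights : ∀ {c M} → c ∈ M → height c ≤ heights M
  height≤heights {M = c ∷ M} (here refl) = ℕ.m≤m+n (height c) (heights M)
  height≤heights {M = d ∷ M} (there c∈M) = ℕ.≤-trans (height≤heights c∈M) (ℕ.m≤n+m (heights M) (height d))

  far∉ : ∀ M → far (suc (heights M)) ∉ M
  far∉ M far∈M = ℕ.<-irrefl refl (subst (_≤ heights M) (far-height (suc (heights M))) (height≤heights far∈M))

  locallyFinite : LocallyFinite B
  locallyFinite = record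
    { _≟_           = λ c d → map′ φ-inj (cong φ) (φ c ≟³ φ d)
    ; fresh         = λ M → far (suc (heights M))
    ; fresh∉        = far∉
    ; nbrs          = λ c → map (λ e → ψ (φ c +³ e)) (dirs c)
    ; nbrs-length   = λ c → ℕ.≤-trans (ℕ.≤-reflexive (length-map _ (dirs c))) (dirs-length c)
    ; nbrs-complete = λ {c} {d} adj → subst (_∈ _) (ψ-displace c d) (∈-map⁺ _ (dirs-complete adj))
    ; Adj-sym       = λ {c} {d} adj → dist⇒Adj (trans (dist³-sym (φ d) (φ c)) (Adj⇒dist adj))
    ; act-Adj       = λ g {c} {d} adj → dist⇒Adj (trans (dist-act g c d) (Adj⇒dist adj))
    ; act-inj       = act-injective
    }

unitVectors : List ℤ³
unitVectors = (+ 1 , +0 , +0) ∷ (+0 , + 1 , +0) ∷ (+0 , +0 , + 1)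
            ∷ (- + 1 , +0 , +0) ∷ (+0 , - + 1 , +0) ∷ (+0 , +0 , - + 1) ∷ []

unitVectors-complete : ∀ e → absSum e ≡ 1 → e ∈ unitVectors
unitVectors-complete e |e|≡1 =
  search 1 (λ e → absSum e ℕ.≟ 1 →-dec e ∈³? unitVectors) e (ℕ.≤-reflexive |e|≡1) |e|≡1

cubicEmbedding : CubeEmbedding cubicBoard
cubicEmbedding = record
  { φ = λ c → c ; ψ = λ v → v ; ψ∘φ = λ _ → refl
  ; adjDist = 1 ; Adj⇒dist = λ adj → adj ; dist⇒Adj = λ d≡1 → d≡1
  ; cubeSym = λ g → g ; φ-act = λ _ _ → refl
  ; dirs = λ _ → unitVectors ; dirs-length = λ _ → ℕ.≤-refl
  ; dirs-complete = λ {c} {d} adj → unitVectors-complete (d -³ c) (trans (dist³-sym d c) adj)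
  ; far = λ n → (+ n , +0 , +0) ; far-height = λ _ → refl
  }

planeZ : ℤ² → ℤ³
planeZ (x , y) = (x , y , +0)

squareVectors : List ℤ³
squareVectors = (+ 1 , +0 , +0) ∷ (+0 , + 1 , +0) ∷ (- + 1 , +0 , +0) ∷ (+0 , - + 1 , +0) ∷ []

squareVectors-complete : ∀ e → absSum e ≡ 1 → proj₂ (proj₂ e) ≡ +0 → e ∈ squareVectors
squareVectors-complete e |e|≡1 =
  search 1 (λ e → absSum e ℕ.≟ 1 →-dec (proj₂ (proj₂ e) ℤ.≟ +0 →-dec e ∈³? squareVectors))
    e (ℕ.≤-reflexive |e|≡1) |e|≡1

squareEmbedding : CubeEmbedding squareBoard
squareEmbedding = record
  { φ = planeZ ; ψ = λ (x , y , _) → (x , y) ; ψ∘φ = λ _ → refl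
  ; adjDist = 1
  ; Adj⇒dist = λ {c} {d} adj → trans (ℕ.+-identityʳ (dist² c d)) adj
  ; dist⇒Adj = λ {c} {d} d≡1 → trans (sym (ℕ.+-identityʳ (dist² c d))) d≡1
  ; cubeSym = λ (s , n₁ , n₂ , (t₁ , t₂)) → (if s then p213 else p123) , n₁ , n₂ , false , (t₁ , t₂ , +0)
  ; φ-act = λ { (true , _) _ → refl ; (false , _) _ → refl }
  ; dirs = λ _ → squareVectors ; dirs-length = λ _ → ℕ.≤-refl
  ; dirs-complete = λ {c} {d} adj → squareVectors-complete _
      (trans (dist³-sym (planeZ d) (planeZ c)) (trans (ℕ.+-identityʳ (dist² c d)) adj)) refl
  ; far = λ n → (+ n , +0) ; far-height = λ _ → refl
  }

hexToCube-plane : ∀ c → coordSum (hexToCube c) ≡ +0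
hexToCube-plane (q , r) = lemma q r
  where
  lemma : ∀ q r → q +ℤ r +ℤ - (q +ℤ r) ≡ +0
  lemma = solve-∀

hexSym : Board.Sym hexBoard → Board.Sym cubicBoard
hexSym (p , n , t) = (p , n , n , n , hexToCube t)

hex-act : ∀ g c → hexToCube (hexAct g c) ≡ cubicAct (hexSym g) (hexToCube c)
hex-act (p , n , t) c = plane-ext (begin
  coordSum (hexToCube (hexAct (p , n , t) c))                ≡⟨ hexToCube-plane (hexAct (p , n , t) c) ⟩
  +0                                                          ≡⟨ negIf-0 n ⟨
  negIf n +0 +ℤ +0                                            ≡⟨ cong₂ (λ s s' → negIf n s +ℤ s')
                                                                       (hexToCube-plane c) (hexToCube-plane t) ⟨
  negIf n (coordSum (hexToCube c)) +ℤ coordSum (hexToCube t)  ≡⟨ coordSum-cubicAct p n (hexToCube t) (hexToCube c) ⟨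
  coordSum (cubicAct (hexSym (p , n , t)) (hexToCube c))      ∎)
  where
  open ≡-Reasoning
  negIf-0 : ∀ n → negIf n +0 +ℤ +0 ≡ +0
  negIf-0 false = refl
  negIf-0 true  = refl

hexVectors : List ℤ³
hexVectors = (+ 1 , - + 1 , +0) ∷ (- + 1 , + 1 , +0) ∷ (+ 1 , +0 , - + 1)
           ∷ (- + 1 , +0 , + 1) ∷ (+0 , + 1 , - + 1) ∷ (+0 , - + 1 , + 1) ∷ []

hexVectors-complete : ∀ e → absSum e ≡ 2 → coordSum e ≡ +0 → e ∈ hexVectors
hexVectors-complete e |e|≡2 =
  search 2 (λ e → absSum e ℕ.≟ 2 →-dec (coordSum e ℤ.≟ +0 →-dec e ∈³? hexVectors))
    e (ℕ.≤-reflexive |e|≡2) |e|≡2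

hex-dirs-complete : ∀ {c d} → dist³ (hexToCube c) (hexToCube d) ≡ 2 → hexToCube d -³ hexToCube c ∈ hexVectors
hex-dirs-complete {c} {d} adj = hexVectors-complete _ (trans (dist³-sym (hexToCube d) (hexToCube c)) adj)
  (trans (coordSum-diff (hexToCube d) (hexToCube c)) (cong₂ _-ℤ_ (hexToCube-plane d) (hexToCube-plane c)))

hexEmbedding : CubeEmbedding hexBoard
hexEmbedding = record
  { φ = hexToCube ; ψ = hexFromCube ; ψ∘φ = λ _ → refl
  ; adjDist = 2 ; Adj⇒dist = λ adj → adj ; dist⇒Adj = λ d≡2 → d≡2
  ; cubeSym = hexSym ; φ-act = hex-act
  ; dirs = λ _ → hexVectors ; dirs-length = λ _ → ℕ.≤-refl
  ; dirs-complete = λ {c} {d} → hex-dirs-complete {c} {d}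
  ; far = λ n → (+ n , +0) ; far-height = λ _ → refl
  }

level : Bool → ℤ
level false = + 1
level true  = + 2

triToCoord-level : ∀ q r b → coordSum (triToCoord (q , r , b)) ≡ level b
triToCoord-level q r false = lemma q r
  where
  lemma : ∀ q r → q +ℤ r +ℤ (+ 1 -ℤ (q +ℤ r)) ≡ + 1
  lemma = solve-∀
triToCoord-level q r true = lemma q r
  where
  lemma : ∀ q r → q +ℤ r +ℤ (+ 2 -ℤ (q +ℤ r)) ≡ + 2
  lemma = solve-∀

triFromCoord-level : ∀ x y z b → coordSum (x , y , z) ≡ level b → triFromCoord (x , y , z) ≡ (x , y , b)
triFromCoord-level x y z false s with (x +ℤ y +ℤ z) ℤ.≟ + 2
... | yes s≡2 = case trans (sym s) s≡2 of λ ()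
... | no  _   = refl
triFromCoord-level x y z true s with (x +ℤ y +ℤ z) ℤ.≟ + 2
... | yes _   = refl
... | no  s≢2 = ⊥-elim (s≢2 s)

triFromCoord∘triToCoord : ∀ c → triFromCoord (triToCoord c) ≡ c
triFromCoord∘triToCoord (q , r , false) = triFromCoord-level q r _ false (triToCoord-level q r false)
triFromCoord∘triToCoord (q , r , true)  = triFromCoord-level q r _ true  (triToCoord-level q r true)

triToCoord-onto : ∀ v b → coordSum v ≡ level b → triToCoord (triFromCoord v) ≡ v
triToCoord-onto (x , y , z) b s rewrite triFromCoord-level x y z b s = onPlane b s
  where
  onPlane : ∀ b → coordSum (x , y , z) ≡ level b → triToCoord (x , y , b) ≡ (x , y , z)
  onPlane false s = plane-ext (trans (triToCoord-level x y false) (sym s))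
  onPlane true  s = plane-ext (trans (triToCoord-level x y true) (sym s))

-- A triangle congruence is a cube congruence: the point reflection
-- v ↦ (1,1,1) - v is a sign change followed by a shift by (1,1,1).
shiftIf : Bool → ℤ³ → ℤ³
shiftIf false t = t
shiftIf true  t = (+ 1 , + 1 , + 1) +³ t

triSym : Board.Sym triangularBoard → Board.Sym cubicBoard
triSym (p , n , t) = (p , n , n , n , shiftIf n (hexToCube t))

triInv-cube : ∀ n w t → triInv n w +³ t ≡ negs n n n w +³ shiftIf n t
triInv-cube false w t = refl
triInv-cube true (x , y , z) (a , b , c) = cong₂ _,_ (lemma x a) (cong₂ _,_ (lemma y b) (lemma z c))
  where
  lemma : ∀ x a → (+ 1 -ℤ x) +ℤ a ≡ - x +ℤ (+ 1 +ℤ a)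
  lemma = solve-∀

triSym-level : ∀ g c → ∃[ b ] coordSum (cubicAct (triSym g) (triToCoord c)) ≡ level b
triSym-level (p , n , t) (q , r , b) = flipped n b , (begin
  coordSum (cubicAct (triSym (p , n , t)) (triToCoord (q , r , b)))
    ≡⟨ coordSum-cubicAct p n (shiftIf n (hexToCube t)) (triToCoord (q , r , b)) ⟩
  negIf n (coordSum (triToCoord (q , r , b))) +ℤ coordSum (shiftIf n (hexToCube t))
    ≡⟨ cong₂ (λ s s' → negIf n s +ℤ s') (triToCoord-level q r b) (shift-sum n) ⟩
  negIf n (level b) +ℤ coordSum (shiftIf n (+0 , +0 , +0))
    ≡⟨ flip-level n b ⟩
  level (flipped n b) ∎)
  where
  open ≡-Reasoning
  shift-sum : ∀ n → coordSum (shiftIf n (hexToCube t)) ≡ coordSum (shiftIf n (+0 , +0 , +0))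
  shift-sum false = hexToCube-plane t
  shift-sum true  = lemma (proj₁ t) (proj₂ t)
    where
    lemma : ∀ q r → (+ 1 +ℤ q) +ℤ (+ 1 +ℤ r) +ℤ (+ 1 +ℤ - (q +ℤ r)) ≡ + 3
    lemma = solve-∀
  flipped : Bool → Bool → Bool
  flipped false b     = b
  flipped true  false = true
  flipped true  true  = false
  flip-level : ∀ n b → negIf n (level b) +ℤ coordSum (shiftIf n (+0 , +0 , +0)) ≡ level (flipped n b)
  flip-level false false = refl
  flip-level false true  = refl
  flip-level true  false = refl
  flip-level true  true  = refl

tri-act : ∀ g c → triToCoord (triAct g c) ≡ cubicAct (triSym g) (triToCoord c)
tri-act (p , n , t) c = begin
  triToCoord (triFromCoord (triInv n (perm3 p (triToCoord c)) +³ hexToCube t))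
    ≡⟨ cong (λ u → triToCoord (triFromCoord u)) (triInv-cube n (perm3 p (triToCoord c)) (hexToCube t)) ⟩
  triToCoord (triFromCoord (cubicAct (triSym (p , n , t)) (triToCoord c)))
    ≡⟨ triToCoord-onto _ (proj₁ (triSym-level (p , n , t) c)) (proj₂ (triSym-level (p , n , t) c)) ⟩
  cubicAct (triSym (p , n , t)) (triToCoord c) ∎
  where open ≡-Reasoning

triangleVectors : Bool → List ℤ³
triangleVectors false = (+ 1 , +0 , +0) ∷ (+0 , + 1 , +0) ∷ (+0 , +0 , + 1) ∷ []
triangleVectors true  = (- + 1 , +0 , +0) ∷ (+0 , - + 1 , +0) ∷ (+0 , +0 , - + 1) ∷ []

triangleVectors-complete : ∀ b b' e → absSum e ≡ 1 → coordSum e ≡ level b' -ℤ level b → e ∈ triangleVectors b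
triangleVectors-complete b b' e |e|≡1 = found b b' e (ℕ.≤-reflexive |e|≡1) |e|≡1
  where
  P : Bool → Bool → Pred ℤ³ 0ℓ
  P b b' e = absSum e ≡ 1 → coordSum e ≡ level b' -ℤ level b → e ∈ triangleVectors b
  P? : ∀ b b' → Decidable (P b b')
  P? b b' e = absSum e ℕ.≟ 1 →-dec (coordSum e ℤ.≟ (level b' -ℤ level b) →-dec e ∈³? triangleVectors b)
  found : ∀ b b' e → absSum e ≤ 1 → P b b' e
  found false false = search 1 (P? false false)
  found false true  = search 1 (P? false true)
  found true  false = search 1 (P? true false)
  found true  true  = search 1 (P? true true)

triangle-dirs-complete : ∀ {c d} → dist³ (triToCoord c) (triToCoord d) ≡ 1 →
  triToCoord d -³ triToCoord c ∈ triangleVectors (proj₂ (proj₂ c))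
triangle-dirs-complete {q , r , b} {q' , r' , b'} adj =
  triangleVectors-complete b b' _ (trans (dist³-sym (triToCoord (q' , r' , b')) (triToCoord (q , r , b))) adj)
    (trans (coordSum-diff (triToCoord (q' , r' , b')) (triToCoord (q , r , b)))
           (cong₂ _-ℤ_ (triToCoord-level q' r' b') (triToCoord-level q r b)))

triangularEmbedding : CubeEmbedding triangularBoard
triangularEmbedding = record
  { φ = triToCoord ; ψ = triFromCoord ; ψ∘φ = triFromCoord∘triToCoord
  ; adjDist = 1 ; Adj⇒dist = λ adj → adj ; dist⇒Adj = λ d≡1 → d≡1
  ; cubeSym = triSym ; φ-act = tri-act
  ; dirs = λ c → triangleVectors (proj₂ (proj₂ c))
  ; dirs-length = λ { (_ , _ , false) → ℕ.≤-refl ; (_ , _ , true) → ℕ.≤-refl }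
  ; dirs-complete = λ {c} {d} → triangle-dirs-complete {c} {d}
  ; far = λ n → (+ n , +0 , false) ; far-height = λ _ → refl
  }

cubeEmbedding : (k : BoardKind) → CubeEmbedding (board k)
cubeEmbedding square     = squareEmbedding
cubeEmbedding triangular = triangularEmbedding
cubeEmbedding hexagonal  = hexEmbedding
cubeEmbedding cubic      = cubicEmbedding

-- The theorem: the isolating strategy defeats every maker strategy.
proposition2p1 : (k : BoardKind) (A : Animal (board k)) (a b : ℕ) →
    1 ≤ a → a < size (board k) A → a * Board.δ (board k) ≤ b →
    Loser (board k) A a b
proposition2p1 k A a b _ a<|A| aδ≤b =
  Isolation.loser (FromCubeEmbedding.locallyFinite (cubeEmbedding k)) A a b a<|A| aδ≤b
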